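{- Let $\mathcal{R}=(\mathcal{X},(\mathcal{M},\mathcal{I}))$ be a reflexive graph category with isomorphisms. The category $\mathsf{Ctx}(\mathcal{R})$ has a terminal object, namely $0$, and has products $n\times 1$ for every object $n$, given by $n+1$ (with first projection $(\mathsf{pr}^{n+1}_0,\ldots,\mathsf{pr}^{n+1}_{n-1}):n+1\to n$ and second projection $(\mathsf{pr}^{n+1}_n):n+1\to 1$).
   Context: Fix a locally small category $\mathcal{C}$ with finite products. An internal category $C$ in $\mathcal{C}$ has object of objects $C_0$, object of morphisms $C_1$, arrows $\mathsf{s}_C,\mathsf{t}_C:C_1\to C_0$, $\mathsf{id}_C:C_0\to C_1$ and composition; write $\mathsf{id}_C[a]=\mathsf{id}_C\circ a$ and $g\circ_C f$ for composition of generalized morphisms $f,g:J\to C_1$. An internal functor $F$ has parts $F_0,F_1$. A reflexive graph category $\mathcal{X}$: internal categories $\mathcal{X}(0),\mathcal{X}(1)$, distinct internal functors $\mathcal{X}(\mathbf{f}_\top),\mathcal{X}(\mathbf{f}_\bot):\mathcal{X}(1)\to\mathcal{X}(0)$, an internal functor $\mathcal{X}(\mathbf{d}):\mathcal{X}(0)\to\mathcal{X}(1)$ with $\mathcal{X}(\mathbf{f}_\star)\circ\mathcal{X}(\mathbf{d})=\mathsf{id}$; $\mathcal{X}^n$ is the levelwise product. A reflexive graph functor $\mathcal{F}:\mathcal{X}\to\mathcal{Y}$ is a pair of internal functors $\mathcal{F}(l):\mathcal{X}(l)\to\mathcal{Y}(l)$; face map-preserving means $\mathcal{Y}(\mathbf{f}_\star)\circ\mathcal{F}(1)=\mathcal{F}(0)\circ\mathcal{X}(\mathbf{f}_\star)$;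 degeneracy-preserving means equipped with an internal natural isomorphism $\varepsilon_\mathcal{F}:\mathcal{Y}(\mathbf{d})\circ\mathcal{F}(0)\Rightarrow\mathcal{F}(1)\circ\mathcal{X}(\mathbf{d})$ with $\mathcal{Y}(\mathbf{f}_\star)_1\circ\varepsilon_\mathcal{F}=\mathsf{id}_{\mathcal{Y}(0)}[\mathcal{F}(0)_0]$. Reflexive graph natural transformations $\eta:\mathcal{F}\to\mathcal{G}$ are pairs of internal natural transformations $\eta(l)$, face map-preserving if $\mathcal{Y}(\mathbf{f}_\star)_1\circ\eta(1)=\eta(0)\circ\mathcal{X}(\mathbf{f}_\star)_0$, degeneracy-preserving if $(\eta(1)\circ\mathcal{X}(\mathbf{d})_0)\circ_{\mathcal{Y}(1)}\varepsilon_\mathcal{F}=\varepsilon_\mathcal{G}\circ_{\mathcal{Y}(1)}(\mathcal{Y}(\mathbf{d})_1\circ\eta(0))$. Composites: levelwise, $\varepsilon_{\mathcal{G}\circ\mathcal{F}}=(\mathcal{G}(1)_1\circ\varepsilon_\mathcal{F})\circ_{\mathcal{Z}(1)}(\varepsilon_\mathcal{G}\circ\mathcal{F}(0)_0)$. Projections $\mathsf{pr}^n_i:\mathcal{X}^n\to\mathcal{X}$ project the $i$-th component with identity $\varepsilon$; tuples $\langle\mathcal{F}_0,\ldots,\mathcal{F}_{m-1}\rangle$ are levelwise with tupled $\varepsilon$. A reflexive graph category with isomorphisms $(\mathcal{X},(\mathcal{M},\mathcal{I}))$: $\mathcal{I}:\mathcal{M}\to\mathcal{X}$ a reflexive graph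 functor with $\mathcal{I}(l)_0$ iso, $\mathcal{I}(l)_1$ monic, commuting strictly with face maps and degeneracies, and every morphism of each $\mathcal{M}(l)$ an isomorphism. The category $\mathcal{M}^n\to\mathcal{M}$ has as objects face map- and degeneracy-preserving reflexive graph functors $\mathcal{M}^n\to\mathcal{M}$. For $\mathbf{F}=(\mathcal{F}_0,\ldots,\mathcal{F}_{m-1})$ a tuple of such objects, $\mathbf{F}^*(\mathcal{G})=\mathcal{G}\circ\langle\mathcal{F}_0,\ldots,\mathcal{F}_{m-1}\rangle$. $\mathsf{Ctx}(\mathcal{R})$: objects natural numbers, morphisms $n\to m$ are $m$-tuples of objects of $\mathcal{M}^n\to\mathcal{M}$, identity $(\mathsf{pr}^n_0,\ldots,\mathsf{pr}^n_{n-1})$, and the composite of $\mathbf{F}:n\to m$ and $\mathbf{G}=(\mathcal{G}_0,\ldots,\mathcal{G}_{k-1}):m\to k$ has $i$-th component $\mathbf{F}^*(\mathcal{G}_i)$. -}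

module Defs where

open import Level using (Level; _⊔_) renaming (suc to lsuc)
open import Data.Nat using (ℕ; zero; suc)
open import Data.Fin using (Fin; zero; suc; inject₁; fromℕ)
open import Data.Product using (Σ; _,_; Σ-syntax; _×_; proj₁; proj₂)
open import Relation.Nullary using (¬_)
open import Relation.Binary using (Rel; IsEquivalence; Setoid)
import Relation.Binary.Reasoning.Setoid as SetoidR

record CartCat (o ℓ e : Level) : Set (lsuc (o ⊔ ℓ ⊔ e)) where
  infixr 9 _∘_
  infix 4 _≈_
  field
    Obj : Set o
    Hom : Obj → Obj → Set ℓ
    _≈_ : ∀ {A B} → Rel (Hom A B) e
    ≈-equiv : ∀ {A B} → IsEquivalence (_≈_ {A} {B})
    id : ∀ {A} → Hom A A
    _∘_ : ∀ {A B C} → Hom B C → Hom A B → Hom A C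
    assoc : ∀ {A B C D} {f : Hom A B} {g : Hom B C} {h : Hom C D} →
            (h ∘ g) ∘ f ≈ h ∘ (g ∘ f)
    identityˡ : ∀ {A B} {f : Hom A B} → id ∘ f ≈ f
    identityʳ : ∀ {A B} {f : Hom A B} → f ∘ id ≈ f
    ∘-resp-≈ : ∀ {A B C} {f f' : Hom B C} {g g' : Hom A B} →
               f ≈ f' → g ≈ g' → f ∘ g ≈ f' ∘ g'
    𝟙 : Obj
    ! : ∀ {A} → Hom A 𝟙
    !-unique : ∀ {A} (f : Hom A 𝟙) → ! ≈ f
    _⊗_ : Obj → Obj → Obj
    π₁ : ∀ {A B} → Hom (A ⊗ B) A
    π₂ : ∀ {A B} → Hom (A ⊗ B) B
    ⟨_,_⟩ : ∀ {A B C} → Hom C A → Hom C B → Hom C (A ⊗ B)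
    project₁ : ∀ {A B C} {f : Hom C A} {g : Hom C B} → π₁ ∘ ⟨ f , g ⟩ ≈ f
    project₂ : ∀ {A B C} {f : Hom C A} {g : Hom C B} → π₂ ∘ ⟨ f , g ⟩ ≈ g
    unique : ∀ {A B C} {f : Hom C A} {g : Hom C B} {h : Hom C (A ⊗ B)} →
             π₁ ∘ h ≈ f → π₂ ∘ h ≈ g → ⟨ f , g ⟩ ≈ h

module _ {o ℓ e : Level} (𝒞 : CartCat o ℓ e) where
  open CartCat 𝒞

  private
    homS : Obj → Obj → Setoid ℓ e
    homS A B = record { Carrier = Hom A B ; _≈_ = _≈_ ; isEquivalence = ≈-equiv }

    refl≈ : ∀ {A B} {f : Hom A B} → f ≈ f
    refl≈ = IsEquivalence.refl ≈-equiv
    sym≈ : ∀ {A B} {f g : Hom A B} → f ≈ g → g ≈ f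
    sym≈ = IsEquivalence.sym ≈-equiv
    trans≈ : ∀ {A B} {f g h : Hom A B} → f ≈ g → g ≈ h → f ≈ h
    trans≈ = IsEquivalence.trans ≈-equiv

    ⟨⟩-cong : ∀ {A B C} {f f' : Hom C A} {g g' : Hom C B} →
              f ≈ f' → g ≈ g' → ⟨ f , g ⟩ ≈ ⟨ f' , g' ⟩
    ⟨⟩-cong p q = sym≈ (unique (trans≈ project₁ p) (trans≈ project₂ q))

  _⊗m_ : ∀ {A B A' B'} → Hom A A' → Hom B B' → Hom (A ⊗ B) (A' ⊗ B')
  f ⊗m g = ⟨ f ∘ π₁ , g ∘ π₂ ⟩

  private
    ⊗m-∘-⟨⟩ : ∀ {A B A' B' C} {a : Hom A A'} {b : Hom B B'} {f : Hom C A} {g : Hom C B} →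
              (a ⊗m b) ∘ ⟨ f , g ⟩ ≈ ⟨ a ∘ f , b ∘ g ⟩
    ⊗m-∘-⟨⟩ {a = a} {b} {f} {g} = sym≈ (unique l r)
      where
      l = begin π₁ ∘ ((a ⊗m b) ∘ ⟨ f , g ⟩) ≈⟨ sym≈ assoc ⟩
                (π₁ ∘ (a ⊗m b)) ∘ ⟨ f , g ⟩ ≈⟨ ∘-resp-≈ project₁ refl≈ ⟩
                (a ∘ π₁) ∘ ⟨ f , g ⟩ ≈⟨ assoc ⟩
                a ∘ (π₁ ∘ ⟨ f , g ⟩) ≈⟨ ∘-resp-≈ refl≈ project₁ ⟩
                a ∘ f ∎
        where open SetoidR (homS _ _)
      r = begin π₂ ∘ ((a ⊗m b) ∘ ⟨ f , g ⟩) ≈⟨ sym≈ assoc ⟩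
                (π₂ ∘ (a ⊗m b)) ∘ ⟨ f , g ⟩ ≈⟨ ∘-resp-≈ project₂ refl≈ ⟩
                (b ∘ π₂) ∘ ⟨ f , g ⟩ ≈⟨ assoc ⟩
                b ∘ (π₂ ∘ ⟨ f , g ⟩) ≈⟨ ∘-resp-≈ refl≈ project₂ ⟩
                b ∘ g ∎
        where open SetoidR (homS _ _)

    split₁ : ∀ {A B A' B' J} {a c : Hom A A'} {b d : Hom B B'} {f g : Hom J (A ⊗ B)} →
             (a ⊗m b) ∘ f ≈ (c ⊗m d) ∘ g → a ∘ (π₁ ∘ f) ≈ c ∘ (π₁ ∘ g)
    split₁ {a = a} {c} {b} {d} {f} {g} p = begin
        a ∘ (π₁ ∘ f) ≈⟨ sym≈ assoc ⟩
        (a ∘ π₁) ∘ f ≈⟨ ∘-resp-≈ (sym≈ project₁) refl≈ ⟩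
        (π₁ ∘ (a ⊗m b)) ∘ f ≈⟨ assoc ⟩
        π₁ ∘ ((a ⊗m b) ∘ f) ≈⟨ ∘-resp-≈ refl≈ p ⟩
        π₁ ∘ ((c ⊗m d) ∘ g) ≈⟨ sym≈ assoc ⟩
        (π₁ ∘ (c ⊗m d)) ∘ g ≈⟨ ∘-resp-≈ project₁ refl≈ ⟩
        (c ∘ π₁) ∘ g ≈⟨ assoc ⟩
        c ∘ (π₁ ∘ g) ∎
      where open SetoidR (homS _ _)

    split₂ : ∀ {A B A' B' J} {a c : Hom A A'} {b d : Hom B B'} {f g : Hom J (A ⊗ B)} →
             (a ⊗m b) ∘ f ≈ (c ⊗m d) ∘ g → b ∘ (π₂ ∘ f) ≈ d ∘ (π₂ ∘ g)
    split₂ {a = a} {c} {b} {d} {f} {g} p = begin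
        b ∘ (π₂ ∘ f) ≈⟨ sym≈ assoc ⟩
        (b ∘ π₂) ∘ f ≈⟨ ∘-resp-≈ (sym≈ project₂) refl≈ ⟩
        (π₂ ∘ (a ⊗m b)) ∘ f ≈⟨ assoc ⟩
        π₂ ∘ ((a ⊗m b) ∘ f) ≈⟨ ∘-resp-≈ refl≈ p ⟩
        π₂ ∘ ((c ⊗m d) ∘ g) ≈⟨ sym≈ assoc ⟩
        (π₂ ∘ (c ⊗m d)) ∘ g ≈⟨ ∘-resp-≈ project₂ refl≈ ⟩
        (d ∘ π₂) ∘ g ≈⟨ assoc ⟩
        d ∘ (π₂ ∘ g) ∎
      where open SetoidR (homS _ _)

  IsIso : ∀ {A B} → Hom A B → Set (ℓ ⊔ e)
  IsIso {A} {B} f = Σ[ g ∈ Hom B A ] (g ∘ f ≈ id × f ∘ g ≈ id)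

  Monic : ∀ {A B} → Hom A B → Set (o ⊔ ℓ ⊔ e)
  Monic {A} f = ∀ {Z} (g h : Hom Z A) → f ∘ g ≈ f ∘ h → g ≈ h

  -- Internal categories, phrased with composition of generalized
  -- morphisms  f, g : J → C₁  with  t ∘ f ≈ s ∘ g;
  -- comp f g p  is  g ∘_C f.

  record ICatD : Set (o ⊔ ℓ ⊔ e) where
    field
      C₀ C₁ : Obj
      s t : Hom C₁ C₀
      i : Hom C₀ C₁
      comp : ∀ {J} (f g : Hom J C₁) → t ∘ f ≈ s ∘ g → Hom J C₁
  open ICatD public

  record ICatLaws (C : ICatD) : Set (o ⊔ ℓ ⊔ e) where
    open ICatD C renaming (s to sC; t to tC; i to iC; comp to compC)
    field
      s-i : sC ∘ iC ≈ id
      t-i : tC ∘ iC ≈ id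
      s-comp : ∀ {J} (f g : Hom J (C₁ C)) p → sC ∘ compC f g p ≈ sC ∘ f
      t-comp : ∀ {J} (f g : Hom J (C₁ C)) p → tC ∘ compC f g p ≈ tC ∘ g
      comp-cong : ∀ {J} {f f' g g' : Hom J (C₁ C)} p p' → f ≈ f' → g ≈ g' →
                  compC f g p ≈ compC f' g' p'
      comp-nat : ∀ {J K} (h : Hom K J) (f g : Hom J (C₁ C)) p q →
                 compC f g p ∘ h ≈ compC (f ∘ h) (g ∘ h) q
      idˡ : ∀ {J} (f : Hom J (C₁ C)) p → compC f (iC ∘ (tC ∘ f)) p ≈ f
      idʳ : ∀ {J} (f : Hom J (C₁ C)) p → compC (iC ∘ (sC ∘ f)) f p ≈ f
      comp-assoc : ∀ {J} (f g h : Hom J (C₁ C)) p q r w →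
                   compC (compC f g p) h q ≈ compC f (compC g h r) w

  AllIso : ICatD → Set (o ⊔ ℓ ⊔ e)
  AllIso C = ∀ {J} (f : Hom J (C₁ C)) →
    Σ[ g ∈ Hom J (C₁ C) ]
      (s C ∘ g ≈ t C ∘ f × t C ∘ g ≈ s C ∘ f
      × (∀ p → comp C f g p ≈ i C ∘ (s C ∘ f))
      × (∀ p → comp C g f p ≈ i C ∘ (t C ∘ f)))

  record IFunD (C D : ICatD) : Set ℓ where
    constructor ifun
    field
      F₀ : Hom (C₀ C) (C₀ D)
      F₁ : Hom (C₁ C) (C₁ D)
  open IFunD public

  record IsIFun {C D : ICatD} (F : IFunD C D) : Set (o ⊔ ℓ ⊔ e) where
    field
      pres-s : s D ∘ F₁ F ≈ F₀ F ∘ s C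
      pres-t : t D ∘ F₁ F ≈ F₀ F ∘ t C
      pres-i : F₁ F ∘ i C ≈ i D ∘ F₀ F
      pres-comp : ∀ {J} (f g : Hom J (C₁ C)) p q →
                  F₁ F ∘ comp C f g p ≈ comp D (F₁ F ∘ f) (F₁ F ∘ g) q

  idF : ∀ {C} → IFunD C C
  idF = ifun id id

  _∘F_ : ∀ {C D E} → IFunD D E → IFunD C D → IFunD C E
  G ∘F F = ifun (F₀ G ∘ F₀ F) (F₁ G ∘ F₁ F)

  _≈F_ : ∀ {C D} → IFunD C D → IFunD C D → Set e
  F ≈F G = (F₀ F ≈ F₀ G) × (F₁ F ≈ F₁ G)

  record IsINat {C D : ICatD} (F G : IFunD C D) (α : Hom (C₀ C) (C₁ D)) : Set (o ⊔ ℓ ⊔ e) where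
    field
      src : s D ∘ α ≈ F₀ F
      tgt : t D ∘ α ≈ F₀ G
      natural : ∀ {J} (f : Hom J (C₁ C)) p q →
                comp D (F₁ F ∘ f) (α ∘ (t C ∘ f)) p ≈ comp D (α ∘ (s C ∘ f)) (F₁ G ∘ f) q

  record IsINatIso {C D : ICatD} (F G : IFunD C D) (α : Hom (C₀ C) (C₁ D)) : Set (o ⊔ ℓ ⊔ e) where
    field
      isNat : IsINat F G α
      inv : Hom (C₀ C) (C₁ D)
      inv-isNat : IsINat G F inv
      inv∘α : ∀ p → comp D α inv p ≈ i D ∘ F₀ F
      α∘inv : ∀ p → comp D inv α p ≈ i D ∘ F₀ G

  record RawRG : Set (o ⊔ ℓ ⊔ e) where
    field
      cat0 cat1 : ICatD
      f⊤ f⊥ : IFunD cat1 cat0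
      d : IFunD cat0 cat1
  open RawRG public

  record RGCat : Set (o ⊔ ℓ ⊔ e) where
    field
      raw : RawRG
      laws0 : ICatLaws (cat0 raw)
      laws1 : ICatLaws (cat1 raw)
      f⊤-fun : IsIFun (f⊤ raw)
      f⊥-fun : IsIFun (f⊥ raw)
      d-fun : IsIFun (d raw)
      distinct : ¬ (f⊤ raw ≈F f⊥ raw)
      f⊤∘d : (f⊤ raw ∘F d raw) ≈F idF
      f⊥∘d : (f⊥ raw ∘F d raw) ≈F idF

  record RGCatIso : Set (o ⊔ ℓ ⊔ e) where
    field
      X M : RGCat
      I0 : IFunD (cat0 (RGCat.raw M)) (cat0 (RGCat.raw X))
      I1 : IFunD (cat1 (RGCat.raw M)) (cat1 (RGCat.raw X))
      I0-fun : IsIFun I0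
      I1-fun : IsIFun I1
      I0-iso₀ : IsIso (F₀ I0)
      I1-iso₀ : IsIso (F₀ I1)
      I0-mono₁ : Monic (F₁ I0)
      I1-mono₁ : Monic (F₁ I1)
      I-f⊤ : (f⊤ (RGCat.raw X) ∘F I1) ≈F (I0 ∘F f⊤ (RGCat.raw M))
      I-f⊥ : (f⊥ (RGCat.raw X) ∘F I1) ≈F (I0 ∘F f⊥ (RGCat.raw M))
      I-d : (d (RGCat.raw X) ∘F I0) ≈F (I1 ∘F d (RGCat.raw M))
      M0-iso : AllIso (cat0 (RGCat.raw M))
      M1-iso : AllIso (cat1 (RGCat.raw M))

  _⊠_ : ICatD → ICatD → ICatD
  C ⊠ D = record
    { C₀ = C₀ C ⊗ C₀ D
    ; C₁ = C₁ C ⊗ C₁ D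
    ; s = s C ⊗m s D
    ; t = t C ⊗m t D
    ; i = i C ⊗m i D
    ; comp = λ f g p → ⟨ comp C (π₁ ∘ f) (π₁ ∘ g) (split₁ p)
                       , comp D (π₂ ∘ f) (π₂ ∘ g) (split₂ p) ⟩
    }

  _⊠F_ : ∀ {C C' D D'} → IFunD C D → IFunD C' D' → IFunD (C ⊠ C') (D ⊠ D')
  F ⊠F G = ifun (F₀ F ⊗m F₀ G) (F₁ F ⊗m F₁ G)

  𝟙Cat : ICatD
  𝟙Cat = record { C₀ = 𝟙 ; C₁ = 𝟙 ; s = id ; t = id ; i = id ; comp = λ f g p → f }

  power : ℕ → ICatD → ICatD
  power zero C = 𝟙Cat
  power (suc n) C = C ⊠ power n C

  powerF : ∀ {C D} (n : ℕ) → IFunD C D → IFunD (power n C) (power n D)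
  powerF zero F = idF
  powerF (suc n) F = F ⊠F powerF n F

  powRG : ℕ → RawRG → RawRG
  powRG n X = record
    { cat0 = power n (cat0 X) ; cat1 = power n (cat1 X)
    ; f⊤ = powerF n (f⊤ X) ; f⊥ = powerF n (f⊥ X) ; d = powerF n (d X) }

  prF : ∀ {C} (n : ℕ) → Fin n → IFunD (power n C) C
  prF (suc n) zero = ifun π₁ π₁
  prF (suc n) (suc j) = prF n j ∘F ifun π₂ π₂

  tup₀ : ∀ {A} {C} (m : ℕ) → (Fin m → Hom A (C₀ C)) → Hom A (C₀ (power m C))
  tup₀ zero f = !
  tup₀ (suc m) f = ⟨ f zero , tup₀ m (λ j → f (suc j)) ⟩

  tup₁ : ∀ {A} {C} (m : ℕ) → (Fin m → Hom A (C₁ C)) → Hom A (C₁ (power m C))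
  tup₁ zero f = !
  tup₁ (suc m) f = ⟨ f zero , tup₁ m (λ j → f (suc j)) ⟩

  tupF : ∀ {C D} (m : ℕ) → (Fin m → IFunD C D) → IFunD C (power m D)
  tupF m F = ifun (tup₀ m (λ j → F₀ (F j))) (tup₁ m (λ j → F₁ (F j)))

  record RawRGF (A B : RawRG) : Set ℓ where
    constructor rgf
    field
      Fun0 : IFunD (cat0 A) (cat0 B)
      Fun1 : IFunD (cat1 A) (cat1 B)
      ε : Hom (C₀ (cat0 A)) (C₁ (cat1 B))
  open RawRGF public

  _≈R_ : ∀ {A B} → RawRGF A B → RawRGF A B → Set e
  F ≈R G = (Fun0 F ≈F Fun0 G) × (Fun1 F ≈F Fun1 G) × (ε F ≈ ε G)

  record IsFDRGF {A B : RawRG} (F : RawRGF A B) : Set (o ⊔ ℓ ⊔ e) where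
    field
      fun0 : IsIFun (Fun0 F)
      fun1 : IsIFun (Fun1 F)
      face⊤ : (f⊤ B ∘F Fun1 F) ≈F (Fun0 F ∘F f⊤ A)
      face⊥ : (f⊥ B ∘F Fun1 F) ≈F (Fun0 F ∘F f⊥ A)
      ε-iso : IsINatIso (d B ∘F Fun0 F) (Fun1 F ∘F d A) (ε F)
      ε-face⊤ : F₁ (f⊤ B) ∘ ε F ≈ i (cat0 B) ∘ F₀ (Fun0 F)
      ε-face⊥ : F₁ (f⊥ B) ∘ ε F ≈ i (cat0 B) ∘ F₀ (Fun0 F)

  module _ (R : RGCatIso) where
    private
      Mr : RawRG
      Mr = RGCat.raw (RGCatIso.M R)

    record CtxObj (n : ℕ) : Set (o ⊔ ℓ ⊔ e) where
      field
        fun : RawRGF (powRG n Mr) Mr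
        isFD : IsFDRGF fun
    open CtxObj public

    CtxHom : ℕ → ℕ → Set (o ⊔ ℓ ⊔ e)
    CtxHom n m = Fin m → CtxObj n

    _≈Ctx_ : ∀ {n m} → CtxHom n m → CtxHom n m → Set e
    _≈Ctx_ {m = m} F G = ∀ (j : Fin m) → fun (F j) ≈R fun (G j)

    prRaw : (n : ℕ) → Fin n → RawRGF (powRG n Mr) Mr
    prRaw n j = rgf (prF n j) (prF n j)
                    (i (cat1 Mr) ∘ (F₀ (d Mr) ∘ F₀ (prF {cat0 Mr} n j)))

    tupRaw : ∀ {n m} → CtxHom n m → RawRGF (powRG n Mr) (powRG m Mr)
    tupRaw {n} {m} F = rgf (tupF m (λ j → Fun0 (fun (F j))))
                           (tupF m (λ j → Fun1 (fun (F j))))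
                           (tup₁ m (λ j → ε (fun (F j))))

    private
      M1 : ICatD
      M1 = cat1 Mr

      src-tup : ∀ {n} m (F : CtxHom n m) →
                s (power m M1) ∘ ε (tupRaw F) ≈ F₀ (powerF m (d Mr)) ∘ F₀ (Fun0 (tupRaw F))
      src-tup zero F = trans≈ (sym≈ (!-unique _)) (!-unique _)
      src-tup (suc m) F =
        trans≈ ⊗m-∘-⟨⟩
          (trans≈ (⟨⟩-cong (IsINat.src (IsINatIso.isNat (IsFDRGF.ε-iso (isFD (F zero)))))
                           (src-tup m (λ j → F (suc j))))
                  (sym≈ ⊗m-∘-⟨⟩))

      composable : ∀ {n m} (F : CtxHom n m) (G : CtxObj m) →
        t M1 ∘ (ε (fun G) ∘ F₀ (Fun0 (tupRaw F))) ≈ s M1 ∘ (F₁ (Fun1 (fun G)) ∘ ε (tupRaw F))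
      composable {n} {m} F G = begin
          t M1 ∘ (εG ∘ T) ≈⟨ sym≈ assoc ⟩
          (t M1 ∘ εG) ∘ T ≈⟨ ∘-resp-≈ (IsINat.tgt (IsINatIso.isNat (IsFDRGF.ε-iso (isFD G)))) refl≈ ⟩
          (G10 ∘ Pd) ∘ T ≈⟨ assoc ⟩
          G10 ∘ (Pd ∘ T) ≈⟨ ∘-resp-≈ refl≈ (sym≈ (src-tup m F)) ⟩
          G10 ∘ (s (power m M1) ∘ εT) ≈⟨ sym≈ assoc ⟩
          (G10 ∘ s (power m M1)) ∘ εT ≈⟨ ∘-resp-≈ (sym≈ (IsIFun.pres-s (IsFDRGF.fun1 (isFD G)))) refl≈ ⟩
          (s M1 ∘ G11) ∘ εT ≈⟨ assoc ⟩
          s M1 ∘ (G11 ∘ εT) ∎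
        where
        open SetoidR (homS _ _)
        εG = ε (fun G)
        T = F₀ (Fun0 (tupRaw F))
        εT = ε (tupRaw F)
        G10 = F₀ (Fun1 (fun G))
        G11 = F₁ (Fun1 (fun G))
        Pd = F₀ (powerF m (d Mr))

    pullback : ∀ {n m} → CtxHom n m → CtxObj m → RawRGF (powRG n Mr) Mr
    pullback F G = rgf (Fun0 (fun G) ∘F Fun0 (tupRaw F))
                       (Fun1 (fun G) ∘F Fun1 (tupRaw F))
                       (comp M1 (ε (fun G) ∘ F₀ (Fun0 (tupRaw F)))
                                (F₁ (Fun1 (fun G)) ∘ ε (tupRaw F))
                                (composable F G))

    _⨾_ : ∀ {n m k} → CtxHom n m → CtxHom m k → Fin k → RawRGF (powRG n Mr) Mr
    (F ⨾ G) j = pullback F (G j)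

    CtxIsTerminal : ℕ → Set (o ⊔ ℓ ⊔ e)
    CtxIsTerminal c = ∀ n → Σ[ h ∈ CtxHom n c ] (∀ (h' : CtxHom n c) → h ≈Ctx h')

    CtxIsProduct : ∀ {a b p} → CtxHom p a → CtxHom p b → Set (o ⊔ ℓ ⊔ e)
    CtxIsProduct {a} {b} {p} q₁ q₂ =
      ∀ k (f : CtxHom k a) (g : CtxHom k b) →
        Σ[ h ∈ CtxHom k p ]
          (((∀ j → (h ⨾ q₁) j ≈R fun (f j)) × (∀ j → (h ⨾ q₂) j ≈R fun (g j)))
          × (∀ (h' : CtxHom k p) → (∀ j → (h' ⨾ q₁) j ≈R fun (f j)) →
               (∀ j → (h' ⨾ q₂) j ≈R fun (g j)) → h ≈Ctx h'))

module Submission where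

-- The whole argument rests on one computation: pulling the
-- projection pr^m_j back along a tuple (H_0, …, H_{m-1}) gives back H_j
-- (pullback-prObj).  Hence composing with the projections of n + 1 just
-- reads off the components of a morphism into n + 1, so a morphism into
-- n + 1 is the same thing as a morphism into n together with one into 1,
-- via  h ↦ (h ∘ inject₁, h (fromℕ n))  with inverse  (f, g) ↦ snoc f g.

open import Defs
open import Level using (Level)
open import Data.Nat using (ℕ; zero; suc)
open import Data.Fin using (Fin; zero; suc; inject₁; fromℕ)
open import Data.Fin.Relation.Unary.Top using (View; ‵fromℕ; ‵inj₁; view; view-fromℕ; view-inject₁)
open import Data.Product using (Σ; Σ-syntax; _×_; _,_; proj₁; proj₂)
open import Relation.Binary using (Setoid; IsEquivalence)
open import Relation.Binary.PropositionalEquality using (_≡_; refl; cong)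
import Relation.Binary.Reasoning.Setoid as SetoidReasoning

snoc : ∀ {a} {A : Set a} n → (Fin n → A) → A → Fin (suc n) → A
snoc n f x i = byView (view i)
  where
  byView : {i : Fin (suc n)} → View i → _
  byView ‵fromℕ = x
  byView (‵inj₁ {i = j} _) = f j

snoc-inject₁ : ∀ {a} {A : Set a} n (f : Fin n → A) x j → snoc n f x (inject₁ j) ≡ f j
snoc-inject₁ n f x j rewrite view-inject₁ j = refl

snoc-fromℕ : ∀ {a} {A : Set a} n (f : Fin n → A) x → snoc n f x (fromℕ n) ≡ x
snoc-fromℕ n f x rewrite view-fromℕ n = refl

initLast-elim : ∀ {p} n (Q : Fin (suc n) → Set p) →
                (∀ j → Q (inject₁ j)) → Q (fromℕ n) → ∀ i → Q i
initLast-elim n Q inits last i with view i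
... | ‵fromℕ = last
... | ‵inj₁ {i = j} _ = inits j

module _ {o ℓ e : Level} (𝒞 : CartCat o ℓ e) where
  open CartCat 𝒞

  homSetoid : Obj → Obj → Setoid ℓ e
  homSetoid A B = record { Carrier = Hom A B ; _≈_ = _≈_ ; isEquivalence = ≈-equiv }

  module HomReasoning {A B : Obj} = SetoidReasoning (homSetoid A B)
  open HomReasoning

  refl≈ : ∀ {A B} {f : Hom A B} → f ≈ f
  refl≈ = IsEquivalence.refl ≈-equiv

  sym≈ : ∀ {A B} {f g : Hom A B} → f ≈ g → g ≈ f
  sym≈ = IsEquivalence.sym ≈-equiv

  trans≈ : ∀ {A B} {f g h : Hom A B} → f ≈ g → g ≈ h → f ≈ h
  trans≈ = IsEquivalence.trans ≈-equiv

  extend-square : ∀ {A B C D E} {x : Hom C D} {a : Hom B C} {b : Hom E D} {y : Hom B E}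
                    {c : Hom A B} → x ∘ a ≈ b ∘ y → x ∘ (a ∘ c) ≈ b ∘ (y ∘ c)
  extend-square sq = trans≈ (sym≈ assoc) (trans≈ (∘-resp-≈ sq refl≈) assoc)

  paste : ∀ {A B C D E F} {x : Hom C D} {a : Hom B C} {b : Hom E D} {y : Hom B E}
            {c : Hom A B} {b' : Hom F E} {z : Hom A F} →
          x ∘ a ≈ b ∘ y → y ∘ c ≈ b' ∘ z → x ∘ (a ∘ c) ≈ (b ∘ b') ∘ z
  paste sq sq' = trans≈ (extend-square sq) (trans≈ (∘-resp-≈ refl≈ sq') (sym≈ assoc))

  paste-π₂ : ∀ {A A' B B' C C'} {x : Hom C C'} {P : Hom B C} {P' : Hom B' C'}
               {y : Hom B B'} {z : Hom A A'} →
             x ∘ P ≈ P' ∘ y → x ∘ (P ∘ π₂) ≈ (P' ∘ π₂) ∘ _⊗m_ 𝒞 z y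
  paste-π₂ sq = paste sq (sym≈ project₂)

  prF-tup₀ : ∀ {A} {C : ICatD 𝒞} m (f : Fin m → Hom A (C₀ C)) (j : Fin m) →
             F₀ (prF 𝒞 {C} m j) ∘ tup₀ 𝒞 {A} {C} m f ≈ f j
  prF-tup₀ (suc m) f zero = project₁
  prF-tup₀ (suc m) f (suc j) = begin
    (F₀ (prF 𝒞 m j) ∘ π₂) ∘ ⟨ f zero , tup₀ 𝒞 m (λ k → f (suc k)) ⟩  ≈⟨ assoc ⟩
    F₀ (prF 𝒞 m j) ∘ (π₂ ∘ ⟨ f zero , tup₀ 𝒞 m (λ k → f (suc k)) ⟩)  ≈⟨ ∘-resp-≈ refl≈ project₂ ⟩
    F₀ (prF 𝒞 m j) ∘ tup₀ 𝒞 m (λ k → f (suc k))                       ≈⟨ prF-tup₀ m (λ k → f (suc k)) j ⟩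
    f (suc j)                                                           ∎

  prF-tup₁ : ∀ {A} {C : ICatD 𝒞} m (f : Fin m → Hom A (C₁ C)) (j : Fin m) →
             F₁ (prF 𝒞 {C} m j) ∘ tup₁ 𝒞 {A} {C} m f ≈ f j
  prF-tup₁ (suc m) f zero = project₁
  prF-tup₁ (suc m) f (suc j) = begin
    (F₁ (prF 𝒞 m j) ∘ π₂) ∘ ⟨ f zero , tup₁ 𝒞 m (λ k → f (suc k)) ⟩  ≈⟨ assoc ⟩
    F₁ (prF 𝒞 m j) ∘ (π₂ ∘ ⟨ f zero , tup₁ 𝒞 m (λ k → f (suc k)) ⟩)  ≈⟨ ∘-resp-≈ refl≈ project₂ ⟩
    F₁ (prF 𝒞 m j) ∘ tup₁ 𝒞 m (λ k → f (suc k))                       ≈⟨ prF-tup₁ m (λ k → f (suc k)) j ⟩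
    f (suc j)                                                           ∎

  prF-natural : ∀ {C D : ICatD 𝒞} (F : IFunD 𝒞 C D) n (j : Fin n) →
                _≈F_ 𝒞 (_∘F_ 𝒞 F (prF 𝒞 n j)) (_∘F_ 𝒞 (prF 𝒞 n j) (powerF 𝒞 n F))
  prF-natural F (suc n) zero = sym≈ project₁ , sym≈ project₁
  prF-natural F (suc n) (suc j) =
    paste-π₂ (proj₁ (prF-natural F n j)) , paste-π₂ (proj₂ (prF-natural F n j))

  prF-isIFun : ∀ {C : ICatD 𝒞} → ICatLaws 𝒞 C → ∀ n (j : Fin n) → IsIFun 𝒞 (prF 𝒞 {C} n j)
  prF-isIFun L (suc n) zero = record
    { pres-s = sym≈ project₁
    ; pres-t = sym≈ project₁
    ; pres-i = project₁
    ; pres-comp = λ f g p q → trans≈ project₁ (ICatLaws.comp-cong L _ q refl≈ refl≈) }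
  prF-isIFun {C} L (suc n) (suc j) = record
    { pres-s = paste-π₂ (IsIFun.pres-s IH)
    ; pres-t = paste-π₂ (IsIFun.pres-t IH)
    ; pres-i = sym≈ (paste-π₂ (sym≈ (IsIFun.pres-i IH)))
    ; pres-comp = pres-comp }
    where
    IH : IsIFun 𝒞 (prF 𝒞 {C} n j)
    IH = prF-isIFun L n j
    P : Hom (C₁ (power 𝒞 n C)) (C₁ C)
    P = F₁ (prF 𝒞 {C} n j)
    -- the tail of a composite is the composite of the tails
    pres-comp : ∀ {J} (f g : Hom J (C₁ (power 𝒞 (suc n) C))) p q →
                (P ∘ π₂) ∘ comp (power 𝒞 (suc n) C) f g p
                  ≈ comp C ((P ∘ π₂) ∘ f) ((P ∘ π₂) ∘ g) q
    pres-comp f g p q = begin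
      (P ∘ π₂) ∘ comp (power 𝒞 (suc n) C) f g p      ≈⟨ assoc ⟩
      P ∘ (π₂ ∘ comp (power 𝒞 (suc n) C) f g p)      ≈⟨ ∘-resp-≈ refl≈ project₂ ⟩
      P ∘ comp (power 𝒞 n C) (π₂ ∘ f) (π₂ ∘ g) _    ≈⟨ IsIFun.pres-comp IH (π₂ ∘ f) (π₂ ∘ g) _ q' ⟩
      comp C (P ∘ (π₂ ∘ f)) (P ∘ (π₂ ∘ g)) q'        ≈⟨ ICatLaws.comp-cong L q' q (sym≈ assoc) (sym≈ assoc) ⟩
      comp C ((P ∘ π₂) ∘ f) ((P ∘ π₂) ∘ g) q         ∎
      where
      q' : t C ∘ (P ∘ (π₂ ∘ f)) ≈ s C ∘ (P ∘ (π₂ ∘ g))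
      q' = trans≈ (∘-resp-≈ refl≈ (sym≈ assoc)) (trans≈ q (∘-resp-≈ refl≈ assoc))

  module _ {D : ICatD 𝒞} (L : ICatLaws 𝒞 D) where
    open ICatLaws L

    s-i-cancel : ∀ {J} (x : Hom J (C₀ D)) → s D ∘ (i D ∘ x) ≈ x
    s-i-cancel x = trans≈ (sym≈ assoc) (trans≈ (∘-resp-≈ s-i refl≈) identityˡ)

    t-i-cancel : ∀ {J} (x : Hom J (C₀ D)) → t D ∘ (i D ∘ x) ≈ x
    t-i-cancel x = trans≈ (sym≈ assoc) (trans≈ (∘-resp-≈ t-i refl≈) identityˡ)

    -- Unit laws for composites whose identity factor is only known up to ≈.
    comp-unitʳ : ∀ {J} (a b : Hom J (C₁ D)) p → b ≈ i D ∘ (t D ∘ a) → comp D a b p ≈ a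
    comp-unitʳ a b p b≈id = trans≈ (comp-cong p p' refl≈ b≈id) (idˡ a p')
      where
      p' : t D ∘ a ≈ s D ∘ (i D ∘ (t D ∘ a))
      p' = sym≈ (s-i-cancel (t D ∘ a))

    comp-unitˡ : ∀ {J} (a b : Hom J (C₁ D)) p → a ≈ i D ∘ (s D ∘ b) → comp D a b p ≈ b
    comp-unitˡ a b p a≈id = trans≈ (comp-cong p p' a≈id refl≈) (idʳ b p')
      where
      p' : t D ∘ (i D ∘ (s D ∘ b)) ≈ s D ∘ b
      p' = t-i-cancel (s D ∘ b)

    identity-isINat : ∀ {C : ICatD 𝒞} (F G : IFunD 𝒞 C D) (X : Hom (C₀ C) (C₀ D)) →
      F₀ F ≈ X → F₀ G ≈ X → F₁ F ≈ F₁ G →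
      s D ∘ F₁ F ≈ X ∘ s C → t D ∘ F₁ F ≈ X ∘ t C →
      IsINat 𝒞 F G (i D ∘ X)
    identity-isINat {C} F G X F₀≈X G₀≈X F₁≈G₁ F-src F-tgt = record
      { src = trans≈ (s-i-cancel X) (sym≈ F₀≈X)
      ; tgt = trans≈ (t-i-cancel X) (sym≈ G₀≈X)
      ; natural = natural }
      where
      natural : ∀ {J} (f : Hom J (C₁ C)) p q →
                comp D (F₁ F ∘ f) ((i D ∘ X) ∘ (t C ∘ f)) p
                  ≈ comp D ((i D ∘ X) ∘ (s C ∘ f)) (F₁ G ∘ f) q
      natural f p q = begin
        comp D (F₁ F ∘ f) ((i D ∘ X) ∘ (t C ∘ f)) p  ≈⟨ comp-unitʳ _ _ p (is-identity F F-tgt) ⟩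
        F₁ F ∘ f                                      ≈⟨ ∘-resp-≈ F₁≈G₁ refl≈ ⟩
        F₁ G ∘ f                                      ≈⟨ comp-unitˡ _ _ q (is-identity G G-src) ⟨
        comp D ((i D ∘ X) ∘ (s C ∘ f)) (F₁ G ∘ f) q  ∎
        where
        is-identity : ∀ (H : IFunD 𝒞 C D) {x : Hom (C₁ D) (C₀ D)} {y : Hom (C₁ C) (C₀ C)} →
                      x ∘ F₁ H ≈ X ∘ y → (i D ∘ X) ∘ (y ∘ f) ≈ i D ∘ (x ∘ (F₁ H ∘ f))
        is-identity H sq = trans≈ assoc (∘-resp-≈ refl≈ (sym≈ (extend-square sq)))
        G-src : s D ∘ F₁ G ≈ X ∘ s C
        G-src = trans≈ (∘-resp-≈ refl≈ (sym≈ F₁≈G₁)) F-src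

    identity-natIso : ∀ {C : ICatD 𝒞} (F G : IFunD 𝒞 C D) → _≈F_ 𝒞 F G →
      s D ∘ F₁ F ≈ F₀ F ∘ s C → t D ∘ F₁ F ≈ F₀ F ∘ t C →
      IsINatIso 𝒞 F G (i D ∘ F₀ F)
    identity-natIso F G (F₀≈G₀ , F₁≈G₁) F-src F-tgt = record
      { isNat = identity-isINat F G (F₀ F) refl≈ (sym≈ F₀≈G₀) F₁≈G₁ F-src F-tgt
      ; inv = i D ∘ F₀ F
      ; inv-isNat = identity-isINat G F (F₀ F) (sym≈ F₀≈G₀) refl≈ (sym≈ F₁≈G₁)
                      (trans≈ (∘-resp-≈ refl≈ (sym≈ F₁≈G₁)) F-src)
                      (trans≈ (∘-resp-≈ refl≈ (sym≈ F₁≈G₁)) F-tgt)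
      ; inv∘α = λ p → comp-unitˡ _ _ p id≈id
      ; α∘inv = λ p → trans≈ (comp-unitˡ _ _ p id≈id) (∘-resp-≈ refl≈ F₀≈G₀) }
      where
      id≈id : i D ∘ F₀ F ≈ i D ∘ (s D ∘ (i D ∘ F₀ F))
      id≈id = ∘-resp-≈ refl≈ (sym≈ (s-i-cancel (F₀ F)))

  retraction-identity : ∀ {C D : ICatD 𝒞} (f : IFunD 𝒞 D C) (δ : IFunD 𝒞 C D) →
    IsIFun 𝒞 f → F₀ f ∘ F₀ δ ≈ id →
    ∀ {J} (x : Hom J (C₀ C)) → F₁ f ∘ (i D ∘ (F₀ δ ∘ x)) ≈ i C ∘ x
  retraction-identity {C} {D} f δ f-fun f∘δ≈id x = begin
    F₁ f ∘ (i D ∘ (F₀ δ ∘ x))   ≈⟨ extend-square (IsIFun.pres-i f-fun) ⟩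
    i C ∘ (F₀ f ∘ (F₀ δ ∘ x))   ≈⟨ ∘-resp-≈ refl≈ (sym≈ assoc) ⟩
    i C ∘ ((F₀ f ∘ F₀ δ) ∘ x)   ≈⟨ ∘-resp-≈ refl≈ (trans≈ (∘-resp-≈ f∘δ≈id refl≈) identityˡ) ⟩
    i C ∘ x                      ∎

  module _ (R : RGCatIso 𝒞) where
    private
      MC : RGCat 𝒞
      MC = RGCatIso.M R
      Mr : RawRG 𝒞
      Mr = RGCat.raw MC
      M1 : ICatD 𝒞
      M1 = cat1 Mr

    prObj : ∀ n (j : Fin n) → CtxObj 𝒞 R n
    prObj n j = record
      { fun = prRaw 𝒞 R n j
      ; isFD = record
        { fun0 = pr₀-fun
        ; fun1 = prF-isIFun (RGCat.laws1 MC) n j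
        ; face⊤ = prF-natural (f⊤ Mr) n j
        ; face⊥ = prF-natural (f⊥ Mr) n j
        ; ε-iso = identity-natIso (RGCat.laws1 MC) (_∘F_ 𝒞 (d Mr) (prF 𝒞 n j))
                    (_∘F_ 𝒞 (prF 𝒞 n j) (powerF 𝒞 n (d Mr))) (prF-natural (d Mr) n j)
                    (paste (IsIFun.pres-s d-fun) (IsIFun.pres-s pr₀-fun))
                    (paste (IsIFun.pres-t d-fun) (IsIFun.pres-t pr₀-fun))
        ; ε-face⊤ = retraction-identity (f⊤ Mr) (d Mr) (RGCat.f⊤-fun MC) (proj₁ (RGCat.f⊤∘d MC)) _
        ; ε-face⊥ = retraction-identity (f⊥ Mr) (d Mr) (RGCat.f⊥-fun MC) (proj₁ (RGCat.f⊥∘d MC)) _ } }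
      where
      d-fun : IsIFun 𝒞 (d Mr)
      d-fun = RGCat.d-fun MC
      pr₀-fun : IsIFun 𝒞 (prF 𝒞 {cat0 Mr} n j)
      pr₀-fun = prF-isIFun (RGCat.laws0 MC) n j

    pullback-prObj : ∀ {k} m (H : CtxHom 𝒞 R k m) (j : Fin m) →
                     _≈R_ 𝒞 (pullback 𝒞 R H (prObj m j)) (fun (H j))
    pullback-prObj {k} m H j =
      (prF-tup₀ m _ j , prF-tup₁ m _ j) , (prF-tup₀ m _ j , prF-tup₁ m _ j) , ε-part _
      where
      εH a b : Hom (C₀ (power 𝒞 k (cat0 Mr))) (C₁ M1)
      εH = ε (fun (H j))
      a = ε (prRaw 𝒞 R m j) ∘ F₀ (Fun0 (tupRaw 𝒞 R H))
      b = F₁ (prF 𝒞 m j) ∘ ε (tupRaw 𝒞 R H)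
      a≈id : a ≈ i M1 ∘ (s M1 ∘ b)
      a≈id = begin
        (i M1 ∘ (F₀ (d Mr) ∘ F₀ (prF 𝒞 m j))) ∘ F₀ (Fun0 (tupRaw 𝒞 R H))  ≈⟨ assoc ⟩
        i M1 ∘ ((F₀ (d Mr) ∘ F₀ (prF 𝒞 m j)) ∘ F₀ (Fun0 (tupRaw 𝒞 R H)))  ≈⟨ ∘-resp-≈ refl≈ assoc ⟩
        i M1 ∘ (F₀ (d Mr) ∘ (F₀ (prF 𝒞 m j) ∘ F₀ (Fun0 (tupRaw 𝒞 R H))))  ≈⟨ ∘-resp-≈ refl≈ (∘-resp-≈ refl≈ (prF-tup₀ m _ j)) ⟩
        i M1 ∘ (F₀ (d Mr) ∘ F₀ (Fun0 (fun (H j))))                           ≈⟨ ∘-resp-≈ refl≈ εH-src ⟨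
        i M1 ∘ (s M1 ∘ εH)                                                   ≈⟨ ∘-resp-≈ refl≈ (∘-resp-≈ refl≈ (prF-tup₁ m _ j)) ⟨
        i M1 ∘ (s M1 ∘ b)                                                    ∎
        where
        εH-src : s M1 ∘ εH ≈ F₀ (d Mr) ∘ F₀ (Fun0 (fun (H j)))
        εH-src = IsINat.src (IsINatIso.isNat (IsFDRGF.ε-iso (isFD (H j))))
      ε-part : ∀ p → comp M1 a b p ≈ εH
      ε-part p = trans≈ (comp-unitˡ (RGCat.laws1 MC) a b p a≈id) (prF-tup₁ m _ j)

    rawSetoid : ℕ → Setoid ℓ e
    rawSetoid k = record
      { Carrier = RawRGF 𝒞 (powRG 𝒞 k Mr) Mr
      ; _≈_ = _≈R_ 𝒞
      ; isEquivalence = record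
        { refl = (refl≈ , refl≈) , (refl≈ , refl≈) , refl≈
        ; sym = λ ((a , b) , (c , d) , x) → (sym≈ a , sym≈ b) , (sym≈ c , sym≈ d) , sym≈ x
        ; trans = λ ((a , b) , (c , d) , x) ((a' , b') , (c' , d') , x') →
            (trans≈ a a' , trans≈ b b') , (trans≈ c c' , trans≈ d d') , trans≈ x x' } }

    -- 0 is terminal: a morphism into 0 is the empty family.
    ctx-terminal : CtxIsTerminal 𝒞 R 0
    ctx-terminal n = (λ ()) , λ _ ()

    ctx-fst : ∀ n → CtxHom 𝒞 R (suc n) n
    ctx-fst n j = prObj (suc n) (inject₁ j)

    ctx-snd : ∀ n → CtxHom 𝒞 R (suc n) 1
    ctx-snd n _ = prObj (suc n) (fromℕ n)

    ctx-product : ∀ n → CtxIsProduct 𝒞 R (ctx-fst n) (ctx-snd n)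
    ctx-product n k f g = h , (h-first , h-second) , h-unique
      where
      open Setoid (rawSetoid k) using () renaming (reflexive to ≡⇒≈R; sym to symR; trans to transR)

      h : CtxHom 𝒞 R k (suc n)
      h = snoc n f (g zero)

      h-init : ∀ j → _≈R_ 𝒞 (fun (h (inject₁ j))) (fun (f j))
      h-init j = ≡⇒≈R (cong fun (snoc-inject₁ n f (g zero) j))

      h-last : _≈R_ 𝒞 (fun (h (fromℕ n))) (fun (g zero))
      h-last = ≡⇒≈R (cong fun (snoc-fromℕ n f (g zero)))

      h-first : ∀ j → _≈R_ 𝒞 (_⨾_ 𝒞 R h (ctx-fst n) j) (fun (f j))
      h-first j = transR (pullback-prObj (suc n) h (inject₁ j)) (h-init j)

      h-second : ∀ (j : Fin 1) → _≈R_ 𝒞 (_⨾_ 𝒞 R h (ctx-snd n) j) (fun (g j))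
      h-second zero = transR (pullback-prObj (suc n) h (fromℕ n)) h-last

      h-unique : ∀ (h' : CtxHom 𝒞 R k (suc n)) →
        (∀ j → _≈R_ 𝒞 (_⨾_ 𝒞 R h' (ctx-fst n) j) (fun (f j))) →
        (∀ j → _≈R_ 𝒞 (_⨾_ 𝒞 R h' (ctx-snd n) j) (fun (g j))) →
        _≈Ctx_ 𝒞 R h h'
      h-unique h' h'-first h'-second = initLast-elim n (λ j → _≈R_ 𝒞 (fun (h j)) (fun (h' j)))
        (λ j → transR (h-init j) (transR (symR (h'-first j)) (pullback-prObj (suc n) h' (inject₁ j))))
        (transR h-last (transR (symR (h'-second zero)) (pullback-prObj (suc n) h' (fromℕ n))))

lemma35 : ∀ {o ℓ e : Level} (𝒞 : CartCat o ℓ e) (R : RGCatIso 𝒞) →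
    CtxIsTerminal 𝒞 R 0
    × (∀ (n : ℕ) →
         Σ[ q₁ ∈ CtxHom 𝒞 R (suc n) n ] Σ[ q₂ ∈ CtxHom 𝒞 R (suc n) 1 ]
           ((∀ (j : Fin n) → _≈R_ 𝒞 (fun (q₁ j)) (prRaw 𝒞 R (suc n) (inject₁ j)))
           × (∀ (j : Fin 1) → _≈R_ 𝒞 (fun (q₂ j)) (prRaw 𝒞 R (suc n) (fromℕ n)))
           × CtxIsProduct 𝒞 R q₁ q₂))
lemma35 𝒞 R = ctx-terminal 𝒞 R , λ n →
  ctx-fst 𝒞 R n , ctx-snd 𝒞 R n ,
  (λ _ → Setoid.refl (rawSetoid 𝒞 R (suc n))) , (λ _ → Setoid.refl (rawSetoid 𝒞 R (suc n))) ,
  ctx-product 𝒞 R n
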